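{- Let $n=p_1p_2\cdots p_r$, where $r\geq 3$ and $p_1<p_2<\cdots<p_r$ are prime numbers. Then $$\delta(\mathcal{P}(C_n))=\min\{\deg(p_sp_{s+1}\cdots p_r): 2\leq s\leq r\}.$$
   Context: For a finite group $G$, the power graph $\mathcal{P}(G)$ is the simple undirected graph with vertex set $G$ in which two distinct vertices are adjacent if one of them is an integral power of the other. $C_n$ denotes the cyclic group of order $n$, identified with $\mathbb{Z}_n=\{0,1,\ldots,n-1\}$; a positive divisor $d$ of $n$ is regarded as the vertex $d \bmod n$. $\deg(a)$ denotes the degree of vertex $a$ in $\mathcal{P}(C_n)$ and $\delta(\mathcal{P}(C_n))$ the minimum degree. -}

module Defs where

open import Data.Nat using (ℕ; zero; suc; _+_; _*_; _∸_; _⊓_; _≡ᵇ_)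
open import Data.Nat.DivMod using (_%_)
open import Data.Bool using (Bool; true; false; not; _∧_; _∨_; if_then_else_)
open import Data.List using (List; map; upTo; foldr)
open import Data.Bool.ListAction using (any)
open import Data.Nat.ListAction using (product)

-- reduction modulo n (the modulus 0 never occurs in the theorem; there we return a)
modN : ℕ → ℕ → ℕ
modN zero    a = a
modN (suc m) a = a % suc m

-- In C_n ≅ ℤ_n (additive), b is an integral power of a iff b ≡ k·a (mod n)
-- for some integer k; since k·a mod n only depends on k mod n, it suffices
-- to let k range over 0, …, n-1.
isPowerOf : ℕ → ℕ → ℕ → Bool
isPowerOf n b a = any (λ k → modN n (k * a) ≡ᵇ modN n b) (upTo n)

adj : ℕ → ℕ → ℕ → Bool
adj n a b = not (modN n a ≡ᵇ modN n b) ∧ (isPowerOf n b a ∨ isPowerOf n a b)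

count : List Bool → ℕ
count = foldr (λ x c → if x then suc c else c) 0

deg : ℕ → ℕ → ℕ
deg n a = count (map (adj n a) (upTo n))

minDeg : ℕ → ℕ
minDeg n = foldr _⊓_ (deg n 0) (map (deg n) (upTo n))

range : ℕ → ℕ → List ℕ
range s r = map (s +_) (upTo (suc r ∸ s))

prodFrom : (ℕ → ℕ) → ℕ → ℕ → ℕ
prodFrom p s r = product (map p (range s r))

tailMinDeg : ℕ → (ℕ → ℕ) → ℕ → ℕ
tailMinDeg n p r = foldr _⊓_ (deg n (modN n (prodFrom p r r)))
                     (map (λ s → deg n (modN n (prodFrom p s r))) (range 2 r))

module Submission where

-- For a vertex a let g = gcd(a, n)
--    and n = g·m with gcd(g, m) = 1.  In ℤ_n, b is a power of a iff g ∣ b,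
--    and a is a power of b iff gcd(b, m) = 1.  These sets have m and g·φ(m)
--    elements and meet in φ(m) elements, so deg(a) + 1 + φ(m) = m + g·φ(m).
--    It rests on counting lemmas (countBelow), the multiplicativity of φ at a
--    prime, and Bézout's identity for the power relation.
-- 2. The divisors of p₁ ⋯ p_r are encoded by Boolean masks over the primes;
--    deg(a) + 1 = (m − φ(m)) + g·φ(m) becomes closedSize, a product formula.
-- 3. Exchange argument (prefix-dominates): replacing the primes of m by the
--    smallest ones does not increase closedSize.  The prefixes of length 0 and
--    r both give n, the prefix of length 1 at most n, so the minimum is taken
--    at some prefix of length 1 ≤ k < r, i.e. at the vertex p_{k+1} ⋯ p_r.
-- 4. The theorem follows by comparing the two minima over lists in Defs.

open import Defs
open import Data.Nat using (ℕ; _≤_; _<_)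
open import Data.Nat.Primality using (Prime)
open import Relation.Binary.PropositionalEquality using (_≡_)

open import Data.Nat
open import Data.Nat.Properties
open import Data.Nat.DivMod
open import Data.Nat.Divisibility
open import Data.Nat.GCD using (gcd; GCD; gcd-GCD; gcd[m,n]∣m; gcd[m,n]∣n; gcd-greatest; module Bézout)
open import Data.Nat.Coprimality using (Coprime; coprime?; coprime-divisor; prime⇒coprime; 1-coprimeTo)
  renaming (sym to coprime-sym)
open import Data.Nat.Primality using (prime⇒irreducible; prime⇒nonZero; prime⇒nonTrivial)
open import Data.Nat.ListAction using (product)
open import Data.Bool using (Bool; true; false; not; _∧_; _∨_; if_then_else_; T)
open import Data.Bool.Properties using (∧-comm; ∧-identityʳ)
open import Data.Bool.ListAction using (any)
open import Data.List using (List; []; _∷_; length; drop; replicate; map; upTo; applyUpTo; foldr)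
open import Data.List.Properties using (length-map; map-applyUpTo; map-upTo; length-upTo; drop-map; drop-all)
open import Data.List.Relation.Unary.All using (All; []; _∷_)
import Data.List.Relation.Unary.All as All
import Data.List.Relation.Unary.All.Properties as AllP
open import Data.List.Relation.Unary.AllPairs using (AllPairs; []; _∷_)
import Data.List.Relation.Unary.AllPairs.Properties as AllPairsP
open import Data.List.Relation.Unary.Any using (here; there)
open import Data.List.Membership.Propositional using (_∈_)
open import Data.List.Membership.Propositional.Properties using (∈-map⁺; ∈-upTo⁺)
open import Data.Product using (∃; _×_; _,_; proj₁; proj₂)
open import Data.Sum using ([_,_])
open import Data.Unit using (tt)
open import Data.Empty using (⊥-elim)
open import Function using (_∘_; mk⇔)
open import Relation.Nullary using (Dec; yes; no; does; ¬_)
open import Relation.Nullary.Decidable using (dec-true; dec-false; does-⇔; ¬?; _×-dec_)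
open import Relation.Binary.PropositionalEquality hiding ([_])
open import Data.Nat.Tactic.RingSolver using (solve-∀)

countBelow : (ℕ → Bool) → ℕ → ℕ
countBelow f zero    = 0
countBelow f (suc n) = if f 0 then suc (countBelow (f ∘ suc) n) else countBelow (f ∘ suc) n

count-applyUpTo : ∀ (f : ℕ → Bool) h n → count (map f (applyUpTo h n)) ≡ countBelow (f ∘ h) n
count-applyUpTo f h zero = refl
count-applyUpTo f h (suc n) with f (h 0)
... | true  = cong suc (count-applyUpTo f (h ∘ suc) n)
... | false = count-applyUpTo f (h ∘ suc) n

countBelow-cong : ∀ (f g : ℕ → Bool) n → (∀ i → i < n → f i ≡ g i) → countBelow f n ≡ countBelow g n
countBelow-cong f g zero    e = refl
countBelow-cong f g (suc n) e rewrite e 0 z<s with g 0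
... | true  = cong suc (countBelow-cong (f ∘ suc) (g ∘ suc) n (λ i i<n → e (suc i) (s<s i<n)))
... | false = countBelow-cong (f ∘ suc) (g ∘ suc) n (λ i i<n → e (suc i) (s<s i<n))

countBelow-+ : ∀ (f : ℕ → Bool) a b → countBelow f (a + b) ≡ countBelow f a + countBelow (λ i → f (a + i)) b
countBelow-+ f zero    b = refl
countBelow-+ f (suc a) b with f 0
... | true  = cong suc (countBelow-+ (f ∘ suc) a b)
... | false = countBelow-+ (f ∘ suc) a b

countBelow-∨ : ∀ (f g : ℕ → Bool) n →
               countBelow (λ i → f i ∨ g i) n + countBelow (λ i → f i ∧ g i) n ≡ countBelow f n + countBelow g n
countBelow-∨ f g zero = refl
countBelow-∨ f g (suc n) with f 0 | g 0 | countBelow-∨ (f ∘ suc) (g ∘ suc) n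
... | true  | true  | ih = cong suc (trans (+-suc _ _) (trans (cong suc ih) (sym (+-suc _ _))))
... | true  | false | ih = cong suc ih
... | false | true  | ih = trans (cong suc ih) (sym (+-suc _ _))
... | false | false | ih = ih

countBelow-partition : ∀ (f g : ℕ → Bool) n →
                       countBelow f n ≡ countBelow (λ i → f i ∧ g i) n + countBelow (λ i → f i ∧ not (g i)) n
countBelow-partition f g zero = refl
countBelow-partition f g (suc n) with f 0 | g 0 | countBelow-partition (f ∘ suc) (g ∘ suc) n
... | true  | true  | ih = cong suc ih
... | true  | false | ih = trans (cong suc ih) (sym (+-suc _ _))
... | false | _     | ih = ih

countBelow-remove : ∀ (f : ℕ → Bool) a n → a < n → f a ≡ true →
                    suc (countBelow (λ i → not (a ≡ᵇ i) ∧ f i) n) ≡ countBelow f n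
countBelow-remove f zero    (suc n) a<n       fa rewrite fa = refl
countBelow-remove f (suc a) (suc n) (s<s a<n) fa with f 0
... | true  = cong suc (countBelow-remove (f ∘ suc) a n a<n fa)
... | false = countBelow-remove (f ∘ suc) a n a<n fa

countBelow-none : ∀ (f : ℕ → Bool) n → (∀ i → i < n → f i ≡ false) → countBelow f n ≡ 0
countBelow-none f zero    e = refl
countBelow-none f (suc n) e rewrite e 0 z<s = countBelow-none (f ∘ suc) n (λ i i<n → e (suc i) (s<s i<n))

countBelow-all : ∀ n → countBelow (λ _ → true) n ≡ n
countBelow-all zero    = refl
countBelow-all (suc n) = cong suc (countBelow-all n)

countBelow-periodic : ∀ (f : ℕ → Bool) m k → (∀ i → f (i + m) ≡ f i) →
                      countBelow f (k * m) ≡ k * countBelow f m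
countBelow-periodic f m zero    per = refl
countBelow-periodic f m (suc k) per = begin
    countBelow f (m + k * m)
  ≡⟨ countBelow-+ f m (k * m) ⟩
    countBelow f m + countBelow (λ i → f (m + i)) (k * m)
  ≡⟨ cong (countBelow f m +_) (countBelow-cong _ f (k * m) (λ i _ → trans (cong f (+-comm m i)) (per i))) ⟩
    countBelow f m + countBelow f (k * m)
  ≡⟨ cong (countBelow f m +_) (countBelow-periodic f m k per) ⟩
    countBelow f m + k * countBelow f m ∎
  where open ≡-Reasoning

_∣ᵇ_ : ℕ → ℕ → Bool
g ∣ᵇ b = does (g ∣? b)

coprimeᵇ : ℕ → ℕ → Bool
coprimeᵇ b m = does (coprime? b m)

does-sound : ∀ {P : Set} (d : Dec P) → does d ≡ true → P
does-sound (yes p) _ = p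

bool-ext : ∀ (x y : Bool) → (x ≡ true → y ≡ true) → (y ≡ true → x ≡ true) → x ≡ y
bool-ext true  y     x⇒y y⇒x = sym (x⇒y refl)
bool-ext false true  x⇒y y⇒x = y⇒x refl
bool-ext false false x⇒y y⇒x = refl

prime≥2 : ∀ {p} → Prime p → 2 ≤ p
prime≥2 {p} pp = nonTrivial⇒n>1 p {{prime⇒nonTrivial pp}}

prime≢1 : ∀ {p} → Prime p → p ≢ 1
prime≢1 pp refl with s≤s () ← prime≥2 pp

∣ᵇ-periodic : ∀ g i → g ∣ᵇ (i + g) ≡ g ∣ᵇ i
∣ᵇ-periodic g i = does-⇔ (mk⇔ (λ h → ∣m+n∣m⇒∣n (subst (g ∣_) (+-comm i g) h) ∣-refl)
                               (λ h → ∣m∣n⇒∣m+n h ∣-refl))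
                         (g ∣? (i + g)) (g ∣? i)

∣ᵇ-below : ∀ g i → suc i < g → g ∣ᵇ suc i ≡ false
∣ᵇ-below g i i<g = dec-false (g ∣? suc i) (λ g∣i → <⇒≱ i<g (∣⇒≤ g∣i))

count-multiples : ∀ g .{{_ : NonZero g}} (Q : ℕ → Bool) m →
                  countBelow (λ b → g ∣ᵇ b ∧ Q b) (m * g) ≡ countBelow (λ c → Q (g * c)) m
count-multiples g Q zero = refl
count-multiples g@(suc g′) Q (suc m) = begin
    countBelow F (g + m * g)
  ≡⟨ countBelow-+ F g (m * g) ⟩
    countBelow F g + countBelow (λ i → F (g + i)) (m * g)
  ≡⟨ cong₂ _+_ one-period (countBelow-cong _ _ (m * g) shift) ⟩
    countBelow Qg 1 + countBelow (λ i → g ∣ᵇ i ∧ Q (g + i)) (m * g)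
  ≡⟨ cong (countBelow Qg 1 +_) (count-multiples g (λ i → Q (g + i)) m) ⟩
    countBelow Qg 1 + countBelow (λ c → Q (g + g * c)) m
  ≡⟨ cong (countBelow Qg 1 +_) (countBelow-cong _ _ m (λ c _ → cong Q (sym (*-suc g c)))) ⟩
    countBelow Qg 1 + countBelow (Qg ∘ suc) m
  ≡⟨ sym (countBelow-+ Qg 1 m) ⟩
    countBelow Qg (suc m) ∎
  where
  open ≡-Reasoning
  F Qg : ℕ → Bool
  F b = g ∣ᵇ b ∧ Q b
  Qg c = Q (g * c)

  shift : ∀ i → i < m * g → F (g + i) ≡ g ∣ᵇ i ∧ Q (g + i)
  shift i _ = cong (_∧ Q (g + i)) (trans (cong (g ∣ᵇ_) (+-comm g i)) (∣ᵇ-periodic g i))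

  -- in [0, g) only 0 is a multiple of g
  one-period : countBelow F g ≡ countBelow Qg 1
  one-period = begin
      countBelow F (1 + g′)
    ≡⟨ countBelow-+ F 1 g′ ⟩
      countBelow F 1 + countBelow (F ∘ suc) g′
    ≡⟨ cong₂ _+_ at-zero (countBelow-none (F ∘ suc) g′ (λ i i<g′ → cong (_∧ Q (suc i)) (∣ᵇ-below g i (s<s i<g′)))) ⟩
      countBelow Qg 1 + 0
    ≡⟨ +-identityʳ _ ⟩
      countBelow Qg 1 ∎
    where
    at-zero : countBelow F 1 ≡ countBelow Qg 1
    at-zero = countBelow-cong F Qg 1 λ
      { zero _ → trans (cong (_∧ Q 0) (dec-true (g ∣? 0) (g ∣0))) (cong Q (sym (*-zeroʳ g)))
      ; (suc i) (s<s ()) }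

φ : ℕ → ℕ
φ m = countBelow (λ b → coprimeᵇ b m) m

φ-1 : φ 1 ≡ 1
φ-1 = cong (λ x → if x then 1 else 0) (dec-true (coprime? 0 1) (λ (_ , d∣1) → ∣1⇒≡1 d∣1))

coprimeᵇ-periodic : ∀ i m → coprimeᵇ (i + m) m ≡ coprimeᵇ i m
coprimeᵇ-periodic i m = does-⇔
  (mk⇔ (λ c {d} (d∣i , d∣m) → c (∣m∣n⇒∣m+n d∣i d∣m , d∣m))
       (λ c {d} (d∣i+m , d∣m) → c (∣m+n∣m⇒∣n (subst (d ∣_) (+-comm i m) d∣i+m) d∣m , d∣m)))
  (coprime? (i + m) m) (coprime? i m)

coprimeᵇ-*ˡ : ∀ g m c → Coprime g m → coprimeᵇ (g * c) m ≡ coprimeᵇ c m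
coprimeᵇ-*ˡ g m c g⊥m = does-⇔
  (mk⇔ (λ gc⊥m {d} (d∣c , d∣m) → gc⊥m (∣n⇒∣m*n g d∣c , d∣m))
       (λ c⊥m {d} (d∣gc , d∣m) → c⊥m (coprime-divisor (λ (e∣d , e∣g) → g⊥m (e∣g , ∣-trans e∣d d∣m)) d∣gc , d∣m)))
  (coprime? (g * c) m) (coprime? c m)

¬∣⇒coprime : ∀ {p d} → Prime p → ¬ (p ∣ d) → Coprime d p
¬∣⇒coprime {p} {d} pp p∤d {e} (e∣d , e∣p) =
  [ (λ e≡1 → e≡1) , (λ e≡p → ⊥-elim (p∤d (subst (_∣ d) e≡p e∣d))) ] (prime⇒irreducible pp e∣p)

coprimeᵇ-prime* : ∀ p m b → Prime p → coprimeᵇ b (p * m) ≡ coprimeᵇ b m ∧ not (p ∣ᵇ b)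
coprimeᵇ-prime* p m b pp = does-⇔
  (mk⇔ (λ b⊥pm → (λ {d} (d∣b , d∣m) → b⊥pm (d∣b , ∣n⇒∣m*n p d∣m)) , (λ p∣b → prime≢1 pp (b⊥pm (p∣b , m∣m*n m))))
       (λ (b⊥m , p∤b) {d} (d∣b , d∣pm) →
          b⊥m (d∣b , coprime-divisor (¬∣⇒coprime pp (λ p∣d → p∤b (∣-trans p∣d d∣b))) d∣pm)))
  (coprime? b (p * m)) (coprime? b m ×-dec ¬? (p ∣? b))

count-coprime-periodic : ∀ m k → countBelow (λ b → coprimeᵇ b m) (k * m) ≡ k * φ m
count-coprime-periodic m k = countBelow-periodic (λ b → coprimeᵇ b m) m k (λ i → coprimeᵇ-periodic i m)

-- Multiplicativity at a prime p coprime to m, in additive form: among the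
-- p·φ(m) numbers b < p·m coprime to m, φ(m) are divisible by p and the
-- remaining ones are exactly those coprime to p·m.
φ-prime*′ : ∀ p m → Prime p → Coprime p m → φ (p * m) + φ m ≡ p * φ m
φ-prime*′ p m pp p⊥m = begin
    φ (p * m) + φ m
  ≡⟨ +-comm (φ (p * m)) (φ m) ⟩
    φ m + φ (p * m)
  ≡⟨ cong₂ _+_ (sym multiples-of-p) (countBelow-cong _ _ (p * m) (λ b _ → coprimeᵇ-prime* p m b pp)) ⟩
    countBelow (λ b → C b ∧ p ∣ᵇ b) (p * m) + countBelow (λ b → C b ∧ not (p ∣ᵇ b)) (p * m)
  ≡⟨ sym (countBelow-partition C (p ∣ᵇ_) (p * m)) ⟩
    countBelow C (p * m)
  ≡⟨ count-coprime-periodic m p ⟩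
    p * φ m ∎
  where
  open ≡-Reasoning
  instance
    p≢0 : NonZero p
    p≢0 = prime⇒nonZero pp
  C : ℕ → Bool
  C b = coprimeᵇ b m
  multiples-of-p : countBelow (λ b → C b ∧ p ∣ᵇ b) (p * m) ≡ φ m
  multiples-of-p = begin
      countBelow (λ b → C b ∧ p ∣ᵇ b) (p * m)
    ≡⟨ countBelow-cong _ _ (p * m) (λ b _ → ∧-comm (C b) (p ∣ᵇ b)) ⟩
      countBelow (λ b → p ∣ᵇ b ∧ C b) (p * m)
    ≡⟨ cong (countBelow (λ b → p ∣ᵇ b ∧ C b)) (*-comm p m) ⟩
      countBelow (λ b → p ∣ᵇ b ∧ C b) (m * p)
    ≡⟨ count-multiples p C m ⟩
      countBelow (λ c → C (p * c)) m
    ≡⟨ countBelow-cong _ C m (λ c _ → coprimeᵇ-*ˡ p m c p⊥m) ⟩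
      φ m ∎

φ-prime* : ∀ p m → Prime p → Coprime p m → φ (p * m) ≡ (p ∸ 1) * φ m
φ-prime* p m pp p⊥m = begin
    φ (p * m)
  ≡⟨ sym (m+n∸n≡m (φ (p * m)) (φ m)) ⟩
    φ (p * m) + φ m ∸ φ m
  ≡⟨ cong₂ _∸_ (φ-prime*′ p m pp p⊥m) (sym (*-identityˡ (φ m))) ⟩
    p * φ m ∸ 1 * φ m
  ≡⟨ sym (*-distribʳ-∸ (φ m) p 1) ⟩
    (p ∸ 1) * φ m ∎
  where open ≡-Reasoning

any-sound : ∀ (f : ℕ → Bool) h n → any f (applyUpTo h n) ≡ true → ∃ λ k → k < n × f (h k) ≡ true
any-sound f h (suc n) e with f (h 0) in fh0
... | true  = 0 , z<s , fh0
... | false with k , k<n , fk ← any-sound f (h ∘ suc) n e = suc k , s<s k<n , fk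

any-complete : ∀ (f : ℕ → Bool) h n k → k < n → f (h k) ≡ true → any f (applyUpTo h n) ≡ true
any-complete f h (suc n) zero    _         e rewrite e = refl
any-complete f h (suc n) (suc k) (s<s k<n) e with f (h 0)
... | true  = refl
... | false = any-complete f (h ∘ suc) n k k<n e

≡ᵇ-sound : ∀ m n → (m ≡ᵇ n) ≡ true → m ≡ n
≡ᵇ-sound m n e = ≡ᵇ⇒≡ m n (subst T (sym e) tt)

≡ᵇ-complete : ∀ m n → m ≡ n → (m ≡ᵇ n) ≡ true
≡ᵇ-complete m n e = T-true (≡⇒≡ᵇ m n e)
  where
  T-true : ∀ {x} → T x → x ≡ true
  T-true {true} _ = refl

-- Bézout's identity modulo n in natural numbers: u·a ≡ gcd(a, n) (mod n).
bézout-mod : ∀ a n′ → ∃ λ u → ∃ λ y → ∃ λ j → u * a + y * suc n′ ≡ j * suc n′ + gcd a (suc n′)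
bézout-mod a n′ with Bézout.identity (gcd-GCD a (suc n′))
... | Bézout.+- x y eq = x , 0 , y , trans (+-identityʳ (x * a)) (trans (sym eq) (+-comm _ (y * suc n′)))
... | Bézout.-+ x y eq = n′ * x , y , x * a , trans (cong (n′ * x * a +_) (sym eq)) (rearrange n′ x a _)
  where
  rearrange : ∀ n′ x a g → n′ * x * a + (g + x * a) ≡ x * a * suc n′ + g
  rearrange = solve-∀

%-shift : ∀ A B k j n .{{_ : NonZero n}} → A + k * n ≡ B + j * n → A % n ≡ B % n
%-shift A B k j n e = trans (sym ([m+kn]%n≡m%n A k n)) (trans (cong (_% n) e) ([m+kn]%n≡m%n B j n))

isPowerOf-sound : ∀ n′ a b → b < suc n′ → isPowerOf (suc n′) b a ≡ true → gcd a (suc n′) ∣ b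
isPowerOf-sound n′ a b b<n e
  with k , _ , ka≡b ← any-sound (λ k → modN (suc n′) (k * a) ≡ᵇ modN (suc n′) b) (λ i → i) (suc n′) e
  = subst (gcd a n ∣_) (trans (≡ᵇ-sound _ _ ka≡b) (m<n⇒m%n≡m b<n))
          (%-presˡ-∣ (∣n⇒∣m*n k (gcd[m,n]∣m a n)) (gcd[m,n]∣n a n))
  where
  n : ℕ
  n = suc n′

-- Conversely, if b = c·gcd(a, n) then b ≡ (u·c)·a with u from Bézout.
isPowerOf-complete : ∀ n′ a b → b < suc n′ → gcd a (suc n′) ∣ b → isPowerOf (suc n′) b a ≡ true
isPowerOf-complete n′ a b b<n (divides c b≡cg) with u , y , j , bez ← bézout-mod a n′ =
  any-complete (λ k → modN n (k * a) ≡ᵇ modN n b) (λ i → i) n ((u * c) % n) (m%n<n (u * c) n)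
    (≡ᵇ-complete _ _ (begin
        ((u * c) % n * a) % n
      ≡⟨ %-distribˡ-* ((u * c) % n) a n ⟩
        ((u * c) % n % n * (a % n)) % n
      ≡⟨ cong (λ z → (z * (a % n)) % n) (m%n%n≡m%n (u * c) n) ⟩
        ((u * c) % n * (a % n)) % n
      ≡⟨ sym (%-distribˡ-* (u * c) a n) ⟩
        (u * c * a) % n
      ≡⟨ %-shift (u * c * a) (c * g) (c * y) (c * j) n
           (trans (factor u c a y n) (trans (cong (c *_) bez) (expand c j n g))) ⟩
        (c * g) % n
      ≡⟨ cong (_% n) (sym b≡cg) ⟩
        b % n ∎))
  where
  open ≡-Reasoning
  n g : ℕ
  n = suc n′
  g = gcd a n
  factor : ∀ u c a y n → u * c * a + c * y * n ≡ c * (u * a + y * n)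
  factor = solve-∀
  expand : ∀ c j n g → c * (j * n + g) ≡ c * g + c * j * n
  expand = solve-∀

module DegreeFormula (n′ a g m : ℕ) (a<n : a < suc n′) (g*m≡n : g * m ≡ suc n′) (g⊥m : Coprime g m)
                     (g-gcd : GCD a (suc n′) g) where

  n : ℕ
  n = suc n′

  n≡m*g : n ≡ m * g
  n≡m*g = trans (sym g*m≡n) (*-comm g m)

  m∣n : m ∣ n
  m∣n = divides g (sym g*m≡n)

  gcd≡g : gcd a n ≡ g
  gcd≡g = GCD.unique (gcd-GCD a n) g-gcd

  instance
    g≢0 : NonZero g
    g≢0 = m*n≢0⇒m≢0 g {{subst NonZero (sym g*m≡n) _}}

  -- D: the powers of a (the multiples of g);  C: the b of which a is a power.
  D C : ℕ → Bool
  D b = g ∣ᵇ b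
  C b = coprimeᵇ b m

  -- gcd(b, n) ∣ a  iff  gcd(b, m) = 1.  (⇒) A common divisor d of b and m
  -- divides gcd(b, n), hence a and so g; as gcd(g, m) = 1, d = 1.
  gcd∣a⇒coprime : ∀ b → gcd b n ∣ a → Coprime b m
  gcd∣a⇒coprime b gcd∣a {d} (d∣b , d∣m) = g⊥m (d∣g , d∣m)
    where
    d∣n : d ∣ n
    d∣n = ∣-trans d∣m m∣n
    d∣g : d ∣ g
    d∣g = GCD.greatest g-gcd (∣-trans (gcd-greatest d∣b d∣n) gcd∣a , d∣n)

  -- (⇐) gcd(b, n) is coprime to m and divides g·m, hence divides g ∣ a.
  coprime⇒gcd∣a : ∀ b → Coprime b m → gcd b n ∣ a
  coprime⇒gcd∣a b b⊥m = ∣-trans (coprime-divisor gcd⊥m (subst (gcd b n ∣_) n≡m*g (gcd[m,n]∣n b n)))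
                                (proj₁ (GCD.commonDivisor g-gcd))
    where
    gcd⊥m : Coprime (gcd b n) m
    gcd⊥m {e} (e∣gcd , e∣m) = b⊥m (∣-trans e∣gcd (gcd[m,n]∣m b n) , e∣m)

  powers-of-a : ∀ b → b < n → isPowerOf n b a ≡ D b
  powers-of-a b b<n = bool-ext _ _
    (λ e → dec-true (g ∣? b) (subst (_∣ b) gcd≡g (isPowerOf-sound n′ a b b<n e)))
    (λ e → isPowerOf-complete n′ a b b<n (subst (_∣ b) (sym gcd≡g) (does-sound (g ∣? b) e)))

  a-power-of : ∀ b → b < n → isPowerOf n a b ≡ C b
  a-power-of b b<n = bool-ext _ _
    (λ e → dec-true (coprime? b m) (gcd∣a⇒coprime b (isPowerOf-sound n′ b a a<n e)))
    (λ e → isPowerOf-complete n′ b a a<n (coprime⇒gcd∣a b (does-sound (coprime? b m) e)))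

  adj≡ : ∀ b → b < n → adj n a b ≡ not (a ≡ᵇ b) ∧ (D b ∨ C b)
  adj≡ b b<n = cong₂ (λ u v → not u ∧ v) (cong₂ _≡ᵇ_ (m<n⇒m%n≡m a<n) (m<n⇒m%n≡m b<n))
                                         (cong₂ _∨_ (powers-of-a b b<n) (a-power-of b b<n))

  -- The closed neighbourhood of a is D ∪ C (a itself lies in D).
  closed-nbhd : suc (deg n a) ≡ countBelow (λ b → D b ∨ C b) n
  closed-nbhd = begin
      suc (count (map (adj n a) (upTo n)))
    ≡⟨ cong suc (count-applyUpTo (adj n a) (λ i → i) n) ⟩
      suc (countBelow (adj n a) n)
    ≡⟨ cong suc (countBelow-cong _ _ n adj≡) ⟩
      suc (countBelow (λ b → not (a ≡ᵇ b) ∧ (D b ∨ C b)) n)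
    ≡⟨ countBelow-remove (λ b → D b ∨ C b) a n a<n (cong (_∨ C a) (dec-true (g ∣? a) (proj₁ (GCD.commonDivisor g-gcd)))) ⟩
      countBelow (λ b → D b ∨ C b) n ∎
    where open ≡-Reasoning

  |D| : countBelow D n ≡ m
  |D| = begin
      countBelow D n
    ≡⟨ cong (countBelow D) n≡m*g ⟩
      countBelow D (m * g)
    ≡⟨ countBelow-cong D (λ b → D b ∧ true) (m * g) (λ b _ → sym (∧-identityʳ (D b))) ⟩
      countBelow (λ b → D b ∧ true) (m * g)
    ≡⟨ count-multiples g (λ _ → true) m ⟩
      countBelow (λ _ → true) m
    ≡⟨ countBelow-all m ⟩
      m ∎
    where open ≡-Reasoning

  |D∩C| : countBelow (λ b → D b ∧ C b) n ≡ φ m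
  |D∩C| = begin
      countBelow (λ b → D b ∧ C b) n
    ≡⟨ cong (countBelow (λ b → D b ∧ C b)) n≡m*g ⟩
      countBelow (λ b → D b ∧ C b) (m * g)
    ≡⟨ count-multiples g C m ⟩
      countBelow (λ c → C (g * c)) m
    ≡⟨ countBelow-cong _ C m (λ c _ → coprimeᵇ-*ˡ g m c g⊥m) ⟩
      φ m ∎
    where open ≡-Reasoning

  |C| : countBelow C n ≡ g * φ m
  |C| = trans (cong (countBelow C) (sym g*m≡n)) (count-coprime-periodic m g)

  formula : suc (deg n a) + φ m ≡ m + g * φ m
  formula = begin
      suc (deg n a) + φ m
    ≡⟨ cong₂ _+_ closed-nbhd (sym |D∩C|) ⟩
      countBelow (λ b → D b ∨ C b) n + countBelow (λ b → D b ∧ C b) n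
    ≡⟨ countBelow-∨ D C n ⟩
      countBelow D n + countBelow C n
    ≡⟨ cong₂ _+_ |D| |C| ⟩
      m + g * φ m ∎
    where open ≡-Reasoning

-- Squarefree divisors of a product of primes L are encoded by masks B : List Bool:
-- the i-th prime goes to the cofactor m when the i-th bit is true, and to the
-- divisor g otherwise (also beyond the end of the mask).
common : List ℕ → List Bool → ℕ
common []      B           = 1
common (p ∷ L) []          = p * common L []
common (p ∷ L) (false ∷ B) = p * common L B
common (p ∷ L) (true  ∷ B) = common L B

cofactor : List ℕ → List Bool → ℕ
cofactor []      B           = 1
cofactor (p ∷ L) []          = cofactor L []
cofactor (p ∷ L) (false ∷ B) = cofactor L B
cofactor (p ∷ L) (true  ∷ B) = p * cofactor L B

-- totient L B = φ(m) = ∏_{p ∣ m} (p − 1)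
totient : List ℕ → List Bool → ℕ
totient []      B           = 1
totient (p ∷ L) []          = totient L []
totient (p ∷ L) (false ∷ B) = totient L B
totient (p ∷ L) (true  ∷ B) = (p ∸ 1) * totient L B

-- nonUnits L B = m − φ(m), computed without subtraction:
-- p·m′ − (p − 1)·φ(m′) = p·(m′ − φ(m′)) + φ(m′).
nonUnits : List ℕ → List Bool → ℕ
nonUnits []      B           = 0
nonUnits (p ∷ L) []          = nonUnits L []
nonUnits (p ∷ L) (false ∷ B) = nonUnits L B
nonUnits (p ∷ L) (true  ∷ B) = p * nonUnits L B + totient L B

-- scaledTotient L B = g·φ(m)
scaledTotient : List ℕ → List Bool → ℕ
scaledTotient []      B           = 1
scaledTotient (p ∷ L) []          = p * scaledTotient L []
scaledTotient (p ∷ L) (false ∷ B) = p * scaledTotient L B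
scaledTotient (p ∷ L) (true  ∷ B) = (p ∸ 1) * scaledTotient L B

-- (m − φ(m)) + g·φ(m): the size of the closed neighbourhood of a vertex with gcd g.
closedSize : List ℕ → List Bool → ℕ
closedSize L B = nonUnits L B + scaledTotient L B

size : List ℕ → List Bool → ℕ
size []      B           = 0
size (p ∷ L) []          = 0
size (p ∷ L) (false ∷ B) = size L B
size (p ∷ L) (true  ∷ B) = suc (size L B)

prefix : ℕ → List Bool
prefix k = replicate k true

common*cofactor : ∀ L B → common L B * cofactor L B ≡ product L
common*cofactor []      B           = refl
common*cofactor (p ∷ L) []          = trans (*-assoc p _ _) (cong (p *_) (common*cofactor L []))
common*cofactor (p ∷ L) (false ∷ B) = trans (*-assoc p _ _) (cong (p *_) (common*cofactor L B))
common*cofactor (p ∷ L) (true  ∷ B) = trans (x*[p*y]≡p*[x*y] (common L B) p (cofactor L B)) (cong (p *_) (common*cofactor L B))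
  where
  x*[p*y]≡p*[x*y] : ∀ x p y → x * (p * y) ≡ p * (x * y)
  x*[p*y]≡p*[x*y] = solve-∀

nonUnits+totient : ∀ L B → All (1 ≤_) L → nonUnits L B + totient L B ≡ cofactor L B
nonUnits+totient []      B           _        = refl
nonUnits+totient (p ∷ L) []          (_ ∷ ps) = nonUnits+totient L [] ps
nonUnits+totient (p ∷ L) (false ∷ B) (_ ∷ ps) = nonUnits+totient L B ps
nonUnits+totient (suc p′ ∷ L) (true ∷ B) (_ ∷ ps) =
  trans (regroup p′ (nonUnits L B) (totient L B)) (cong (suc p′ *_) (nonUnits+totient L B ps))
  where
  regroup : ∀ p′ x t → suc p′ * x + t + p′ * t ≡ suc p′ * (x + t)
  regroup = solve-∀

scaledTotient≡ : ∀ L B → scaledTotient L B ≡ common L B * totient L B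
scaledTotient≡ []      B           = refl
scaledTotient≡ (p ∷ L) []          = trans (cong (p *_) (scaledTotient≡ L [])) (sym (*-assoc p _ _))
scaledTotient≡ (p ∷ L) (false ∷ B) = trans (cong (p *_) (scaledTotient≡ L B)) (sym (*-assoc p _ _))
scaledTotient≡ (p ∷ L) (true  ∷ B) = trans (cong ((p ∸ 1) *_) (scaledTotient≡ L B)) (x*[y*z]≡y*[x*z] (p ∸ 1) (common L B) (totient L B))
  where
  x*[y*z]≡y*[x*z] : ∀ x y z → x * (y * z) ≡ y * (x * z)
  x*[y*z]≡y*[x*z] = solve-∀

-- The empty mask describes the vertex 0: g = n, m = 1.
totient-[] : ∀ L → totient L [] ≡ 1
totient-[] []      = refl
totient-[] (p ∷ L) = totient-[] L

nonUnits-[] : ∀ L → nonUnits L [] ≡ 0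
nonUnits-[] []      = refl
nonUnits-[] (p ∷ L) = nonUnits-[] L

scaledTotient-[] : ∀ L → scaledTotient L [] ≡ product L
scaledTotient-[] []      = refl
scaledTotient-[] (p ∷ L) = cong (p *_) (scaledTotient-[] L)

common-[] : ∀ L → common L [] ≡ product L
common-[] []      = refl
common-[] (p ∷ L) = cong (p *_) (common-[] L)

common-prefix : ∀ L k → common L (prefix k) ≡ product (drop k L)
common-prefix []      zero    = refl
common-prefix []      (suc k) = refl
common-prefix (p ∷ L) zero    = cong (p *_) (common-[] L)
common-prefix (p ∷ L) (suc k) = common-prefix L k

size≤length : ∀ L B → size L B ≤ length L
size≤length []      B           = z≤n
size≤length (p ∷ L) []          = z≤n
size≤length (p ∷ L) (false ∷ B) = m≤n⇒m≤1+n (size≤length L B)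
size≤length (p ∷ L) (true  ∷ B) = s≤s (size≤length L B)

Dominated : List ℕ → List Bool → List Bool → Set
Dominated L B B′ = nonUnits L B ≤ nonUnits L B′
                 × totient L B ≤ totient L B′
                 × scaledTotient L B ≤ scaledTotient L B′

dominated-refl : ∀ L B → Dominated L B B
dominated-refl L B = ≤-refl , ≤-refl , ≤-refl

dominated-trans : ∀ L B B′ B″ → Dominated L B B′ → Dominated L B′ B″ → Dominated L B B″
dominated-trans L B B′ B″ (x₁ , t₁ , s₁) (x₂ , t₂ , s₂) = ≤-trans x₁ x₂ , ≤-trans t₁ t₂ , ≤-trans s₁ s₂

dominated-∷ : ∀ p L b B B′ → Dominated L B B′ → Dominated (p ∷ L) (b ∷ B) (b ∷ B′)
dominated-∷ p L true  B B′ (x , t , s) = +-mono-≤ (*-monoʳ-≤ p x) t , *-monoʳ-≤ (p ∸ 1) t , *-monoʳ-≤ (p ∸ 1) s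
dominated-∷ p L false B B′ (x , t , s) = x , t , *-monoʳ-≤ p s

*-exchange-≤ : ∀ p′ q′ S → p′ ≤ q′ → p′ * (suc q′ * S) ≤ suc p′ * (q′ * S)
*-exchange-≤ p′ q′ S p′≤q′ =
  subst₂ _≤_ (sym (expandˡ p′ q′ S)) (sym (expandʳ p′ q′ S)) (+-monoˡ-≤ (p′ * q′ * S) (*-monoˡ-≤ S p′≤q′))
  where
  expandˡ : ∀ p′ q′ S → p′ * (suc q′ * S) ≡ p′ * S + p′ * q′ * S
  expandˡ = solve-∀
  expandʳ : ∀ p′ q′ S → suc p′ * (q′ * S) ≡ q′ * S + p′ * q′ * S
  expandʳ = solve-∀

-- Exchange step: if p is at most every element of L, then moving p into the
-- cofactor in place of the (t+1)-th element of L is an improvement.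
exchange : ∀ p′ L t → All (suc p′ ≤_) L → suc t ≤ length L →
           Dominated (suc p′ ∷ L) (true ∷ prefix t) (false ∷ prefix (suc t))
exchange p′ (suc q′ ∷ L) zero (s≤s p′≤q′ ∷ _) _
  rewrite nonUnits-[] L | totient-[] L | *-zeroʳ (suc p′) | *-zeroʳ (suc q′) =
  ≤-refl , *-monoˡ-≤ 1 p′≤q′ , *-exchange-≤ p′ q′ (scaledTotient L []) p′≤q′
exchange p′ (suc q′ ∷ L) (suc u) (_ ∷ p≤L) (s≤s u<len)
  with x , t , s ← exchange p′ L u p≤L u<len =
    subst (_≤ suc q′ * nonUnits L (prefix (suc u)) + totient L (prefix (suc u)))
          (sym (swap-nonUnits p′ q′ (nonUnits L (prefix u)) (totient L (prefix u))))
          (+-mono-≤ (*-monoʳ-≤ (suc q′) x) t)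
  , subst (_≤ q′ * totient L (prefix (suc u))) (sym (swap-* p′ q′ (totient L (prefix u)))) (*-monoʳ-≤ q′ t)
  , subst (_≤ suc p′ * (q′ * scaledTotient L (prefix (suc u)))) (sym (swap-* p′ q′ (scaledTotient L (prefix u))))
      (subst (q′ * (p′ * scaledTotient L (prefix u)) ≤_) (swap-* q′ (suc p′) (scaledTotient L (prefix (suc u))))
        (*-monoʳ-≤ q′ s))
  where
  swap-nonUnits : ∀ p′ q′ X T → suc p′ * (suc q′ * X + T) + q′ * T ≡ suc q′ * (suc p′ * X + T) + p′ * T
  swap-nonUnits = solve-∀
  swap-* : ∀ p′ q′ T → p′ * (q′ * T) ≡ q′ * (p′ * T)
  swap-* = solve-∀

-- For an increasing list of positive numbers, the prefix mask of the same size
-- dominates every mask: repeatedly exchange a prime of m for a smaller one.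
prefix-dominates : ∀ L B → All (1 ≤_) L → AllPairs _<_ L → Dominated L (prefix (size L B)) B
prefix-dominates []      B           _        _            = dominated-refl [] B
prefix-dominates (p ∷ L) []          _        _            = dominated-refl (p ∷ L) []
prefix-dominates (p ∷ L) (true ∷ B)  (_ ∷ ps) (_ ∷ sorted) =
  dominated-∷ p L true (prefix (size L B)) B (prefix-dominates L B ps sorted)
prefix-dominates (suc p′ ∷ L) (false ∷ B) (_ ∷ ps) (p<L ∷ sorted)
  with size L B | size≤length L B | prefix-dominates L B ps sorted
... | zero  | _   | dom = dominated-∷ (suc p′) L false [] B dom
... | suc k | len | dom =
  dominated-trans (suc p′ ∷ L) (true ∷ prefix k) (false ∷ prefix (suc k)) (false ∷ B)
    (exchange p′ L k (All.map <⇒≤ p<L) len) (dominated-∷ (suc p′) L false (prefix (suc k)) B dom)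

primes-positive : ∀ {L} → All Prime L → All (1 ≤_) L
primes-positive = All.map (λ pp → ≤-trans (s≤s z≤n) (prime≥2 pp))

coprime-* : ∀ {a b c} → Coprime a b → Coprime a c → Coprime a (b * c)
coprime-* a⊥b a⊥c {d} (d∣a , d∣bc) = a⊥c (d∣a , coprime-divisor (λ {e} (e∣d , e∣b) → a⊥b (∣-trans e∣d d∣a , e∣b)) d∣bc)

coprime-primes : ∀ {p q} → Prime p → Prime q → p < q → Coprime p q
coprime-primes pp pq p<q = coprime-sym (prime⇒coprime pq {{prime⇒nonZero pp}} p<q)

coprime-parts : ∀ p L B → Prime p → All Prime L → All (p <_) L →
                Coprime p (common L B) × Coprime p (cofactor L B)
coprime-parts p [] B pp _ _ = coprime-sym (1-coprimeTo p) , coprime-sym (1-coprimeTo p)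
coprime-parts p (q ∷ L) [] pp (pq ∷ ps) (p<q ∷ p<L)
  with g , m ← coprime-parts p L [] pp ps p<L = coprime-* (coprime-primes pp pq p<q) g , m
coprime-parts p (q ∷ L) (false ∷ B) pp (pq ∷ ps) (p<q ∷ p<L)
  with g , m ← coprime-parts p L B pp ps p<L = coprime-* (coprime-primes pp pq p<q) g , m
coprime-parts p (q ∷ L) (true ∷ B) pp (pq ∷ ps) (p<q ∷ p<L)
  with g , m ← coprime-parts p L B pp ps p<L = g , coprime-* (coprime-primes pp pq p<q) m

common⊥cofactor : ∀ L B → All Prime L → AllPairs _<_ L → Coprime (common L B) (cofactor L B)
common⊥cofactor []      B           _          _            = 1-coprimeTo 1
common⊥cofactor (p ∷ L) []          (pp ∷ ps) (p<L ∷ sorted) =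
  coprime-sym (coprime-* (coprime-sym (proj₂ (coprime-parts p L [] pp ps p<L)))
                         (coprime-sym (common⊥cofactor L [] ps sorted)))
common⊥cofactor (p ∷ L) (false ∷ B) (pp ∷ ps) (p<L ∷ sorted) =
  coprime-sym (coprime-* (coprime-sym (proj₂ (coprime-parts p L B pp ps p<L)))
                         (coprime-sym (common⊥cofactor L B ps sorted)))
common⊥cofactor (p ∷ L) (true ∷ B)  (pp ∷ ps) (p<L ∷ sorted) =
  coprime-* (coprime-sym (proj₁ (coprime-parts p L B pp ps p<L))) (common⊥cofactor L B ps sorted)

φ-cofactor : ∀ L B → All Prime L → AllPairs _<_ L → φ (cofactor L B) ≡ totient L B
φ-cofactor []      B           _         _              = φ-1
φ-cofactor (p ∷ L) []          (_ ∷ ps)  (_ ∷ sorted)   = φ-cofactor L [] ps sorted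
φ-cofactor (p ∷ L) (false ∷ B) (_ ∷ ps)  (_ ∷ sorted)   = φ-cofactor L B ps sorted
φ-cofactor (p ∷ L) (true ∷ B)  (pp ∷ ps) (p<L ∷ sorted) =
  trans (φ-prime* p (cofactor L B) pp (proj₂ (coprime-parts p L B pp ps p<L)))
        (cong ((p ∸ 1) *_) (φ-cofactor L B ps sorted))

divisor-mask : ∀ L d → All Prime L → d ∣ product L → ∃ λ B → common L B ≡ d
divisor-mask []      d _ d∣1 = [] , sym (∣1⇒≡1 d∣1)
divisor-mask (p ∷ L) d (pp ∷ ps) d∣pL with p ∣? d
... | yes (divides q d≡qp)
  with B , eq ← divisor-mask L q ps (*-cancelʳ-∣ p {{prime⇒nonZero pp}}
                                       (subst (_∣ product L * p) d≡qp (subst (d ∣_) (*-comm p (product L)) d∣pL)))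
  = (false ∷ B) , trans (cong (p *_) eq) (trans (*-comm p q) (sym d≡qp))
... | no p∤d with B , eq ← divisor-mask L d ps (coprime-divisor (¬∣⇒coprime pp p∤d) d∣pL) = (true ∷ B) , eq

deg-mask : ∀ n′ a L B → All Prime L → AllPairs _<_ L → product L ≡ suc n′ → a < suc n′ →
           GCD a (suc n′) (common L B) → suc (deg (suc n′) a) ≡ closedSize L B
deg-mask n′ a L B primes sorted L≡n a<n g-gcd = +-cancelʳ-≡ (totient L B) _ _ (begin
    suc (deg (suc n′) a) + t
  ≡⟨ cong (suc (deg (suc n′) a) +_) (sym (φ-cofactor L B primes sorted)) ⟩
    suc (deg (suc n′) a) + φ m
  ≡⟨ DegreeFormula.formula n′ a g m a<n (trans (common*cofactor L B) L≡n) (common⊥cofactor L B primes sorted) g-gcd ⟩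
    m + g * φ m
  ≡⟨ cong₂ (λ u v → u + g * v) (sym (nonUnits+totient L B (primes-positive primes))) (φ-cofactor L B primes sorted) ⟩
    x + t + g * t
  ≡⟨ cong (x + t +_) (sym (scaledTotient≡ L B)) ⟩
    x + t + s
  ≡⟨ +-assoc x t s ⟩
    x + (t + s)
  ≡⟨ cong (x +_) (+-comm t s) ⟩
    x + (s + t)
  ≡⟨ sym (+-assoc x s t) ⟩
    closedSize L B + t ∎)
  where
  open ≡-Reasoning
  g m t x s : ℕ
  g = common L B
  m = cofactor L B
  t = totient L B
  x = nonUnits L B
  s = scaledTotient L B

product-positive : ∀ L → All (1 ≤_) L → 1 ≤ product L
product-positive []      _          = s≤s z≤n
product-positive (p ∷ L) (1≤p ∷ ps) = *-mono-≤ 1≤p (product-positive L ps)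

-- The vertex 0 (empty mask) has closed neighbourhood of size n …
closedSize-[] : ∀ L → closedSize L [] ≡ product L
closedSize-[] L = cong₂ _+_ (nonUnits-[] L) (scaledTotient-[] L)

-- … and so has a generator (g = 1, m = n).
closedSize-full : ∀ L → All (1 ≤_) L → closedSize L (prefix (length L)) ≡ product L
closedSize-full L ps = begin
    nonUnits L P + scaledTotient L P
  ≡⟨ cong (nonUnits L P +_) (scaledTotient≡ L P) ⟩
    nonUnits L P + common L P * totient L P
  ≡⟨ cong (λ z → nonUnits L P + z * totient L P) common≡1 ⟩
    nonUnits L P + 1 * totient L P
  ≡⟨ cong (nonUnits L P +_) (*-identityˡ (totient L P)) ⟩
    nonUnits L P + totient L P
  ≡⟨ nonUnits+totient L P ps ⟩
    cofactor L P
  ≡⟨ sym (*-identityˡ (cofactor L P)) ⟩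
    1 * cofactor L P
  ≡⟨ cong (_* cofactor L P) (sym common≡1) ⟩
    common L P * cofactor L P
  ≡⟨ common*cofactor L P ⟩
    product L ∎
  where
  open ≡-Reasoning
  P : List Bool
  P = prefix (length L)
  common≡1 : common L P ≡ 1
  common≡1 = trans (common-prefix L (length L)) (cong product (drop-all (length L) L ≤-refl))

-- The vertex p₂ ⋯ p_r has closed neighbourhood of size 1 + (p₁ − 1)·p₂ ⋯ p_r ≤ n.
closedSize-first : ∀ L → All (1 ≤_) L → 1 ≤ length L → closedSize L (prefix 1) ≤ product L
closedSize-first (suc p′ ∷ L) (_ ∷ ps) _ rewrite nonUnits-[] L | totient-[] L | scaledTotient-[] L | *-zeroʳ (suc p′) =
  +-monoˡ-≤ (p′ * product L) (product-positive L ps)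

best-prefix : ∀ L B → All (1 ≤_) L → AllPairs _<_ L → 2 ≤ length L →
              ∃ λ k → 1 ≤ k × k < length L × closedSize L (prefix k) ≤ closedSize L B
best-prefix L B ps sorted 2≤len
  with x , _ , s ← prefix-dominates L B ps sorted = from-size (size L B) (size≤length L B) (+-mono-≤ x s)
  where
  first≤n : closedSize L (prefix 1) ≤ product L
  first≤n = closedSize-first L ps (≤-trans (s≤s z≤n) 2≤len)
  from-size : ∀ t → t ≤ length L → closedSize L (prefix t) ≤ closedSize L B →
              ∃ λ k → 1 ≤ k × k < length L × closedSize L (prefix k) ≤ closedSize L B
  from-size zero _ le = 1 , ≤-refl , 2≤len , ≤-trans first≤n (subst (_≤ closedSize L B) (closedSize-[] L) le)
  from-size (suc t) t≤len le with suc t <? length L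
  ... | yes t<len = suc t , s≤s z≤n , t<len , le
  ... | no  t≮len = 1 , ≤-refl , 2≤len , ≤-trans first≤n
      (subst (_≤ closedSize L B) (trans (cong (closedSize L ∘ prefix) (≤-antisym t≤len (≮⇒≥ t≮len))) (closedSize-full L ps)) le)

cofactor-positive : ∀ L B → All (1 ≤_) L → 1 ≤ cofactor L B
cofactor-positive []      B           _          = s≤s z≤n
cofactor-positive (p ∷ L) []          (_ ∷ ps)   = cofactor-positive L [] ps
cofactor-positive (p ∷ L) (false ∷ B) (_ ∷ ps)   = cofactor-positive L B ps
cofactor-positive (p ∷ L) (true ∷ B)  (1≤p ∷ ps) = *-mono-≤ 1≤p (cofactor-positive L B ps)

common-prefix<product : ∀ L k → All Prime L → 1 ≤ k → 1 ≤ length L → common L (prefix k) < product L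
common-prefix<product (p ∷ L) (suc k) (pp ∷ ps) _ _ =
  subst (c <_) (common*cofactor (p ∷ L) (prefix (suc k)))
        (m<m*n c (p * cofactor L (prefix k)) {{c≢0}}
               (*-mono-≤ (prime≥2 pp) (cofactor-positive L (prefix k) (primes-positive ps))))
  where
  c : ℕ
  c = common L (prefix k)
  c≢0 : NonZero c
  c≢0 = m*n≢0⇒m≢0 c {{>-nonZero (subst (1 ≤_) (sym (common*cofactor (p ∷ L) (prefix (suc k))))
                                        (product-positive (p ∷ L) (primes-positive (pp ∷ ps))))}}

drop-applyUpTo : ∀ {A : Set} (f : ℕ → A) k n → drop k (applyUpTo f n) ≡ applyUpTo (f ∘ (k +_)) (n ∸ k)
drop-applyUpTo f zero    n       = refl
drop-applyUpTo f (suc k) zero    = refl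
drop-applyUpTo f (suc k) (suc n) = drop-applyUpTo (f ∘ suc) k n

prodFrom-prefix : ∀ (p : ℕ → ℕ) r k → prodFrom p (suc k) r ≡ common (map p (range 1 r)) (prefix k)
prodFrom-prefix p r k = sym (trans (common-prefix (map p (range 1 r)) k) (cong product (begin
    drop k (map p (map (1 +_) (upTo r)))
  ≡⟨ drop-map k (map (1 +_) (upTo r)) ⟩
    map p (drop k (map (1 +_) (upTo r)))
  ≡⟨ cong (map p) (drop-map k (upTo r)) ⟩
    map p (map (1 +_) (drop k (upTo r)))
  ≡⟨ cong (map p ∘ map (1 +_)) (drop-applyUpTo (λ i → i) k r) ⟩
    map p (map (1 +_) (applyUpTo (k +_) (r ∸ k)))
  ≡⟨ cong (map p) (map-applyUpTo (k +_) (1 +_) (r ∸ k)) ⟩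
    map p (applyUpTo (λ i → suc k + i) (r ∸ k))
  ≡⟨ cong (map p) (sym (map-upTo (suc k +_) (r ∸ k))) ⟩
    map p (range (suc k) r) ∎)))
  where open ≡-Reasoning

∈-range : ∀ {a s r} → a ≤ s → s ≤ r → s ∈ range a r
∈-range {a} {s} {r} a≤s s≤r =
  subst (_∈ range a r) (m+[n∸m]≡n a≤s) (∈-map⁺ (a +_) (∈-upTo⁺ (∸-monoˡ-< (s≤s s≤r) a≤s)))

foldr-⊓-≤ : ∀ b {x} xs → x ∈ xs → foldr _⊓_ b xs ≤ x
foldr-⊓-≤ b (y ∷ xs) (here refl)  = m⊓n≤m y _
foldr-⊓-≤ b (y ∷ xs) (there x∈xs) = ≤-trans (m⊓n≤n y _) (foldr-⊓-≤ b xs x∈xs)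

foldr-⊓-greatest : ∀ {z} b xs → z ≤ b → All (z ≤_) xs → z ≤ foldr _⊓_ b xs
foldr-⊓-greatest b []       z≤b []           = z≤b
foldr-⊓-greatest b (x ∷ xs) z≤b (z≤x ∷ z≤xs) = ⊓-glb z≤x (foldr-⊓-greatest b xs z≤b z≤xs)

minDeg≤deg : ∀ n′ z → minDeg (suc n′) ≤ deg (suc n′) (modN (suc n′) z)
minDeg≤deg n′ z = foldr-⊓-≤ _ _ (∈-map⁺ (deg (suc n′)) (∈-upTo⁺ (m%n<n z (suc n′))))

minDeg≤tailMinDeg : ∀ n′ p r → minDeg (suc n′) ≤ tailMinDeg (suc n′) p r
minDeg≤tailMinDeg n′ p r =
  foldr-⊓-greatest _ _ (minDeg≤deg n′ (prodFrom p r r))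
                   (AllP.map⁺ (All.universal (λ s → minDeg≤deg n′ (prodFrom p s r)) (range 2 r)))

module PrimeList (r : ℕ) (p : ℕ → ℕ) (primes : ∀ i → 1 ≤ i → i ≤ r → Prime (p i))
                 (increasing : ∀ i j → 1 ≤ i → i < j → j ≤ r → p i < p j) where

  L : List ℕ
  L = map p (range 1 r)

  L-primes : All Prime L
  L-primes = AllP.map⁺ (AllP.map⁺ (AllP.applyUpTo⁺₁ (λ i → i) r (λ {i} i<r → primes (suc i) (s≤s z≤n) i<r)))

  L-sorted : AllPairs _<_ L
  L-sorted = AllPairsP.map⁺ (AllPairsP.map⁺
    (AllPairsP.applyUpTo⁺₁ (λ i → i) r (λ i<j j<r → increasing _ _ (s≤s z≤n) (s<s i<j) j<r)))

  L-length : length L ≡ r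
  L-length = trans (length-map p (range 1 r)) (trans (length-map (1 +_) (upTo r)) (length-upTo r))

  -- Every vertex x has degree at least that of some v = p_{k+1} ⋯ p_r with
  -- 1 ≤ k < r: write gcd(x, n) as a mask B, take the best prefix k for B, and
  -- compare deg(x) + 1 and deg(v) + 1 through deg-mask.
  tailMinDeg≤deg : ∀ n′ → 3 ≤ r → suc n′ ≡ prodFrom p 1 r → ∀ x → x < suc n′ → tailMinDeg (suc n′) p r ≤ deg (suc n′) x
  tailMinDeg≤deg n′ 3≤r n≡L x x<n
    with B , B≡gcd ← divisor-mask L (gcd x (suc n′)) L-primes (subst (gcd x (suc n′) ∣_) n≡L (gcd[m,n]∣n x (suc n′)))
    with k , 1≤k , k<len , best ← best-prefix L B (primes-positive L-primes) L-sorted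
                                              (subst (2 ≤_) (sym L-length) (≤-trans (n≤1+n 2) 3≤r))
    = begin
      tailMinDeg n p r
    ≤⟨ foldr-⊓-≤ _ _ (∈-map⁺ (λ s → deg n (modN n (prodFrom p s r))) (∈-range (s≤s 1≤k) k<r)) ⟩
      deg n (modN n (prodFrom p (suc k) r))
    ≡⟨ cong (deg n) (trans (cong (_% n) (prodFrom-prefix p r k)) (m<n⇒m%n≡m v<n)) ⟩
      deg n v
    ≤⟨ s≤s⁻¹ (subst₂ _≤_ (sym deg-v) (sym deg-x) best) ⟩
      deg n x ∎
    where
    open ≤-Reasoning
    n v : ℕ
    n = suc n′
    v = common L (prefix k)
    L≡n : product L ≡ n
    L≡n = sym n≡L
    k<r : k < r
    k<r = subst (k <_) L-length k<len
    v<n : v < n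
    v<n = subst (v <_) L≡n (common-prefix<product L k L-primes 1≤k (subst (1 ≤_) (sym L-length) (≤-trans (s≤s z≤n) 3≤r)))
    v∣n : v ∣ n
    v∣n = divides (cofactor L (prefix k)) (sym (trans (*-comm _ v) (trans (common*cofactor L (prefix k)) L≡n)))
    deg-x : suc (deg n x) ≡ closedSize L B
    deg-x = deg-mask n′ x L B L-primes L-sorted L≡n x<n (subst (GCD x n) (sym B≡gcd) (gcd-GCD x n))
    deg-v : suc (deg n v) ≡ closedSize L (prefix k)
    deg-v = deg-mask n′ v L (prefix k) L-primes L-sorted L≡n v<n (GCD.is (∣-refl , v∣n) proj₁)

lemma3p1 : (n r : ℕ) (p : ℕ → ℕ) → 3 ≤ r →
           (∀ i → 1 ≤ i → i ≤ r → Prime (p i)) →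
           (∀ i j → 1 ≤ i → i < j → j ≤ r → p i < p j) →
           n ≡ prodFrom p 1 r →
           minDeg n ≡ tailMinDeg n p r
lemma3p1 zero r p _ primes increasing 0≡L =
  ⊥-elim (<-irrefl refl (subst (1 ≤_) (sym 0≡L) (product-positive L (primes-positive L-primes))))
  where open PrimeList r p primes increasing
lemma3p1 (suc n′) r p 3≤r primes increasing n≡L =
  ≤-antisym (minDeg≤tailMinDeg n′ p r)
            (foldr-⊓-greatest _ _ (tailMin≤ 0 z<s) (AllP.map⁺ (AllP.applyUpTo⁺₁ (λ i → i) (suc n′) (tailMin≤ _))))
  where
  open PrimeList r p primes increasing
  tailMin≤ : ∀ x → x < suc n′ → tailMinDeg (suc n′) p r ≤ deg (suc n′) x
  tailMin≤ = tailMinDeg≤deg n′ 3≤r n≡L
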